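{- Let $\mathcal{D}$ be a fixed degree sequence and let $T$ be a tree that minimizes the Sombor index among all trees with degree sequence $\mathcal{D}$. Let $P=v_1v_2\dots v_t$ be a path in $T$ with $t\ge 4$ and $d(v_1)<d(v_t)$. Then $d(v_2)\le d(v_{t-1})$.
   Context: For a graph $G=(V,E)$ with vertex degrees $d(v)$, the Sombor index is ${\rm SO}(G)=\sum_{uv\in E}\sqrt{d(u)^2+d(v)^2}$. A vertex of degree $1$ is pendant. A tree has degree sequence $(d_1,\dots,d_k)$ (non-increasing, pendant vertices omitted) if it has exactly $k$ non-pendant vertices and their degrees, as a multiset, are $d_1,\dots,d_k$. -}

module Defs where

open import Data.Bool using (Bool; true; false; if_then_else_; _∧_; T)
open import Data.Nat using (ℕ; zero; suc; _+_; _*_; _^_; _≤_; _<_; _≤ᵇ_; _<ᵇ_)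
open import Data.Fin using (Fin; toℕ)
open import Data.List using (List; []; _∷_; _++_; map; length; concatMap; take)
open import Data.Nat.ListAction using (sum)
open import Data.Empty using (⊥)
open import Data.List.Base using (allFin)
open import Data.Product using (_×_; _,_; ∃)
open import Relation.Binary.PropositionalEquality using (_≡_)
open import Data.List.Relation.Unary.Linked using (Linked)
open import Data.List.Relation.Unary.Unique.Propositional using (Unique)
open import Data.List.Relation.Binary.Permutation.Propositional using (_↭_)

record Graph (n : ℕ) : Set where
  field
    adj     : Fin n → Fin n → Bool
    symm    : ∀ u v → adj u v ≡ adj v u
    irrefl  : ∀ u → adj u u ≡ false

open Graph public

Adj : ∀ {n} → Graph n → Fin n → Fin n → Set
Adj G u v = T (adj G u v)

deg : ∀ {n} → Graph n → Fin n → ℕ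
deg {n} G u = sum (map (λ v → if adj G u v then 1 else 0) (allFin n))

data Walk {n} (G : Graph n) : Fin n → Fin n → Set where
  here : ∀ {u} → Walk G u u
  step : ∀ {u w v} → Adj G u w → Walk G w v → Walk G u v

Connected : ∀ {n} → Graph n → Set
Connected G = ∀ u v → Walk G u v

IsPath : ∀ {n} → Graph n → List (Fin n) → Set
IsPath G xs = Unique xs × Linked (Adj G) xs

IsCycle : ∀ {n} → Graph n → List (Fin n) → Set
IsCycle G xs = 3 ≤ length xs × Unique xs × Linked (Adj G) (xs ++ take 1 xs)

Acyclic : ∀ {n} → Graph n → Set
Acyclic G = ∀ xs → IsCycle G xs → ⊥

IsTree : ∀ {n} → Graph n → Set
IsTree G = Connected G × Acyclic G

nonPendant : List ℕ → List ℕ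
nonPendant [] = []
nonPendant (1 ∷ ds) = nonPendant ds
nonPendant (d ∷ ds) = d ∷ nonPendant ds

HasDegSeq : ∀ {n} → Graph n → List ℕ → Set
HasDegSeq {n} G D = nonPendant (map (deg G) (allFin n)) ↭ D

-- Sombor index, encoded exactly without real numbers.
-- SO(G) = Σ_{uv∈E} √(d(u)²+d(v)²); we keep the list of radicands.

edges : ∀ {n} → Graph n → List (Fin n × Fin n)
edges {n} G = concatMap (λ u → concatMap (λ v →
    if adj G u v ∧ (toℕ u <ᵇ toℕ v) then (u , v) ∷ [] else []) (allFin n)) (allFin n)

somborRadicands : ∀ {n} → Graph n → List ℕ
somborRadicands G = map (λ e → let (u , v) = e in
    deg G u * deg G u + deg G v * deg G v) (edges G)

-- integer square root: isqrt m = ⌊√m⌋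
isqrt : ℕ → ℕ
isqrt zero = zero
isqrt (suc m) with suc (isqrt m) * suc (isqrt m) ≤ᵇ suc m
... | true  = suc (isqrt m)
... | false = isqrt m

-- Σ_{a∈as} √a ≤ Σ_{b∈bs} √b, exactly: for every precision k,
-- Σ ⌊2^k √a⌋ ≤ Σ ⌊2^k √b⌋ + |bs|.  (This is equivalent to the real
-- inequality.)
SqrtSum≤ : List ℕ → List ℕ → Set
SqrtSum≤ as bs = ∀ (k : ℕ) →
  sum (map (λ a → isqrt (a * 4 ^ k)) as)
    ≤ sum (map (λ b → isqrt (b * 4 ^ k)) bs) + length bs

SO≤ : ∀ {n m} → Graph n → Graph m → Set
SO≤ G H = SqrtSum≤ (somborRadicands G) (somborRadicands H)

IsSOMinimal : ∀ {n} → List ℕ → Graph n → Set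
IsSOMinimal {n} D G =
  IsTree G × HasDegSeq G D ×
  (∀ (m : ℕ) (H : Graph m) → IsTree H → HasDegSeq H D → SO≤ G H)

{-# OPTIONS --safe #-}
module Submission where

-- If d(v₂) > d(vₜ₋₁), replace the edges v₁v₂ and vₜ₋₁vₜ by v₁vₜ₋₁ and v₂vₜ. Every vertex
-- keeps its degree, and the subpath v₂ … vₜ₋₁ joins the three pieces left by the deletion into
-- a tree again, so the result competes with T. Writing a, b, c, e for the degrees of v₁, v₂,
-- vₜ₋₁, vₜ, the Sombor index changes by √(a² + c²) + √(b² + e²) − √(a² + b²) − √(c² + e²) < 0:
-- both pairs of radicands have the same sum, and
-- (a² + b²)(c² + e²) − (a² + c²)(b² + e²) = (b² − c²)(e² − a²) > 0.
-- As SO≤ compares sums of ⌊2ᵏ √·⌋ at every precision k, up to a slack of one unit per edge,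
-- the strict decrease is made visible by choosing k large.

open import Defs
open import Data.Nat.Properties hiding (_≟_)
open import Algebra.Properties.CommutativeMonoid.Sum +-0-commutativeMonoid
  using (sum-syntax; sum-cong-≗; sum-remove; sum-replicate-zero; ∑-distrib-+)
open import Algebra.Properties.CommutativeSemigroup +-commutativeSemigroup
  using () renaming (interchange to +-interchange)
open import Data.Bool.Base using (Bool; true; false; T; if_then_else_; _∧_; _xor_)
open import Data.Empty using (⊥; ⊥-elim)
open import Data.Fin.Base using (Fin; toℕ; punchIn; punchOut)
import Data.Fin.Base as Fin
open import Data.Fin.Properties using (_≟_; toℕ-injective; punchInᵢ≢i; punchIn-punchOut; punchIn-injective)
open import Data.List.Base
  using (List; []; _∷_; _++_; map; tabulate; allFin; concatMap; take; length; initLast; _∷ʳ′_)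
open import Data.List.Properties
  using ( map-tabulate; map-++; map-∘; map-cong; ++-assoc; ++-identityʳ; ∷ʳ-injective; ∷-injectiveˡ
        ; length-++)
import Data.List.Membership.DecPropositional as DecMembership
open import Data.List.Membership.Propositional using (_∈_)
open import Data.List.Relation.Binary.Permutation.Propositional using (_↭_)
open import Data.List.Relation.Unary.All as All using (All; []; _∷_)
import Data.List.Relation.Unary.All.Properties as All
open import Data.List.Relation.Unary.All.Properties using (¬Any⇒All¬)
open import Data.List.Relation.Unary.AllPairs using ([]; _∷_)
open import Data.List.Relation.Unary.Any using (here; there)
open import Data.List.Relation.Unary.Linked as Linked using (Linked; []; [-]; _∷_)
open import Data.List.Relation.Unary.Unique.Propositional using (Unique)
import Data.List.Relation.Unary.Unique.Propositional.Properties as Unique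
open import Data.Nat.Base using (ℕ; zero; suc; _+_; _*_; _^_; _≤_; _<_; _≤ᵇ_; _<ᵇ_; z≤n; s≤s; NonZero)
import Data.Nat.ListAction as List
open import Data.Nat.ListAction.Properties using (sum-++)
open import Data.Nat.Tactic.RingSolver using (solve-∀)
open import Data.Product.Base using (_×_; _,_; proj₁; proj₂; ∃-syntax)
open import Data.Sum.Base using (_⊎_; inj₁; inj₂; [_,_]′)
open import Function.Base using (id; _∘_; case_of_)
open import Level using (0ℓ)
open import Relation.Binary.Construct.Closure.ReflexiveTransitive as Star using (Star; ε; _◅_; _◅◅_; _⋆)
open import Relation.Binary.Core using (Rel)
open import Relation.Binary.PropositionalEquality
  using (_≡_; _≢_; refl; sym; trans; cong; cong₂; subst; subst₂; module ≡-Reasoning)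
open import Relation.Nullary using (¬_; Dec; yes; no; does)
open import Relation.Nullary.Decidable using (_×-dec_; _⊎-dec_; dec-false; T?)

-- Sums of integer square roots

isqrt-bounds : ∀ m → isqrt m * isqrt m ≤ m × m < suc (isqrt m) * suc (isqrt m)
isqrt-bounds zero = z≤n , s≤s z≤n
isqrt-bounds (suc m) with isqrt-bounds m
... | lo , hi with suc (isqrt m) * suc (isqrt m) ≤ᵇ suc m in eq
... | true  = ≤ᵇ⇒≤ _ _ (subst T (sym eq) _) , ≤-<-trans hi (*-mono-< (n<1+n r) (n<1+n r))
  where r = suc (isqrt m)
... | false = m≤n⇒m≤1+n lo , ≰⇒> (λ le → subst T eq (≤⇒≤ᵇ le))

isqrt²≤ : ∀ m → isqrt m * isqrt m ≤ m
isqrt²≤ m = proj₁ (isqrt-bounds m)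

<suc-isqrt² : ∀ m → m < suc (isqrt m) * suc (isqrt m)
<suc-isqrt² m = proj₂ (isqrt-bounds m)

square-cancel-≤ : ∀ {x y} → x * x ≤ y * y → x ≤ y
square-cancel-≤ x²≤y² = ≮⇒≥ (λ y<x → <⇒≱ (*-mono-< y<x y<x) x²≤y²)

square-cancel-< : ∀ {x y} → x * x < y * y → x < y
square-cancel-< x²<y² = ≰⇒> (λ y≤x → <⇒≱ x²<y² (*-mono-≤ y≤x y≤x))

n≤n*n : ∀ n → n ≤ n * n
n≤n*n zero    = z≤n
n≤n*n (suc n) = m≤m*n (suc n) (suc n)

n<2^n : ∀ n → n < 2 ^ n
n<2^n zero    = s≤s z≤n
n<2^n (suc n) = +-mono-≤ (m^n>0 2 n) (≤-trans (n<2^n n) (m≤m+n (2 ^ n) 0))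

4^n≡2^n*2^n : ∀ n → 4 ^ n ≡ 2 ^ n * 2 ^ n
4^n≡2^n*2^n zero    = refl
4^n≡2^n*2^n (suc n) = trans (cong (4 *_) (4^n≡2^n*2^n n)) (square-double (2 ^ n))
  where
  square-double : ∀ x → 4 * (x * x) ≡ (2 * x) * (2 * x)
  square-double = solve-∀

-- With p, q the successors of ⌊√α⌋, ⌊√β⌋, squaring gives r s + w ≤ p q, and then
-- (r + s + m + 1)² ≤ γ + δ + 2 (r s + w) < (p + q)².
isqrt-sum-≤ : ∀ {α β γ δ} m → α + β ≡ γ + δ →
  let r = isqrt γ ; s = isqrt δ ; w = suc m * (r + s + suc m) in
  γ * δ + (2 * (r * s) * w + w * w) ≤ α * β →
  r + s + m ≤ isqrt α + isqrt β
isqrt-sum-≤ {α} {β} {γ} {δ} m sums≡ products≤ =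
  ≤-pred (≤-pred (subst₂ _<_ (+-suc (r + s) m) (cong suc (+-suc (isqrt α) (isqrt β))) r+s+M<p+q))
  where
  open ≤-Reasoning
  r s M w p q : ℕ
  r = isqrt γ
  s = isqrt δ
  M = suc m
  w = M * (r + s + M)
  p = suc (isqrt α)
  q = suc (isqrt β)

  expand-product : ∀ x y z → (x * y + z) * (x * y + z) ≡ (x * x) * (y * y) + (2 * (x * y) * z + z * z)
  expand-product = solve-∀

  expand-sum : ∀ x y z → (x + y + z) * (x + y + z) + z * z ≡ x * x + y * y + 2 * (x * y + z * (x + y + z))
  expand-sum = solve-∀

  square-sum : ∀ x y → x * x + y * y + 2 * (x * y) ≡ (x + y) * (x + y)
  square-sum = solve-∀

  product-of-squares : ∀ x y → (x * x) * (y * y) ≡ (x * y) * (x * y)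
  product-of-squares = solve-∀

  rs+w≤pq : r * s + w ≤ p * q
  rs+w≤pq = <⇒≤ (square-cancel-< (begin-strict
    (r * s + w) * (r * s + w)                   ≡⟨ expand-product r s w ⟩
    (r * r) * (s * s) + (2 * (r * s) * w + w * w) ≤⟨ +-monoˡ-≤ _ (*-mono-≤ (isqrt²≤ γ) (isqrt²≤ δ)) ⟩
    γ * δ + (2 * (r * s) * w + w * w)           ≤⟨ products≤ ⟩
    α * β                                       <⟨ *-mono-< (<suc-isqrt² α) (<suc-isqrt² β) ⟩
    (p * p) * (q * q)                           ≡⟨ product-of-squares p q ⟩
    (p * q) * (p * q)                           ∎))

  r+s+M<p+q : r + s + M < p + q
  r+s+M<p+q = square-cancel-< (begin-strict
    (r + s + M) * (r + s + M)             ≤⟨ m≤m+n _ (M * M) ⟩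
    (r + s + M) * (r + s + M) + M * M     ≡⟨ expand-sum r s M ⟩
    r * r + s * s + 2 * (r * s + w)       ≤⟨ +-monoˡ-≤ _ (+-mono-≤ (isqrt²≤ γ) (isqrt²≤ δ)) ⟩
    γ + δ + 2 * (r * s + w)               ≡⟨ cong (_+ 2 * (r * s + w)) (sym sums≡) ⟩
    α + β + 2 * (r * s + w)
      <⟨ +-mono-<-≤ (+-mono-< (<suc-isqrt² α) (<suc-isqrt² β)) (*-monoʳ-≤ 2 rs+w≤pq) ⟩
    p * p + q * q + 2 * (p * q)           ≡⟨ square-sum p q ⟩
    (p + q) * (p + q)                     ∎)

isqrt-scaled-≤ : ∀ C t → isqrt (C * (t * t)) ≤ C * t
isqrt-scaled-≤ C t = square-cancel-≤ (begin
  isqrt (C * (t * t)) * isqrt (C * (t * t)) ≤⟨ isqrt²≤ (C * (t * t)) ⟩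
  C * (t * t)                               ≤⟨ *-monoˡ-≤ (t * t) (n≤n*n C) ⟩
  C * C * (t * t)                           ≡⟨ regroup C t ⟩
  C * t * (C * t)                           ∎)
  where
  open ≤-Reasoning
  regroup : ∀ x y → x * x * (y * y) ≡ x * y * (x * y)
  regroup = solve-∀

-- The rounding slack of isqrt-sum-≤ at scale t² grows only like t³.
rounding-slack-≤ : ∀ M C D t .{{_ : NonZero t}} →
  let r = isqrt (C * (t * t)) ; s = isqrt (D * (t * t)) ; w = M * (r + s + M) ; c = M * (C + D + M) in
  2 * (r * s) * w + w * w ≤ (2 * (C * D) * c + c * c) * (t * t * t)
rounding-slack-≤ M C D t = begin
  2 * (r * s) * w + w * w
    ≤⟨ +-mono-≤ (*-mono-≤ (*-monoʳ-≤ 2 (*-mono-≤ r≤Ct s≤Dt)) w≤ct) (*-mono-≤ w≤ct w≤ct) ⟩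
  2 * (C * t * (D * t)) * (c * t) + c * t * (c * t)
    ≡⟨ regroup C D c t ⟩
  2 * (C * D) * c * (t * t * t) + c * c * (t * t)
    ≤⟨ +-monoʳ-≤ _ (*-monoʳ-≤ (c * c) (m≤m*n (t * t) t)) ⟩
  2 * (C * D) * c * (t * t * t) + c * c * (t * t * t)
    ≡⟨ *-distribʳ-+ (t * t * t) (2 * (C * D) * c) (c * c) ⟨
  (2 * (C * D) * c + c * c) * (t * t * t)
    ∎
  where
  open ≤-Reasoning
  r s w c : ℕ
  r = isqrt (C * (t * t))
  s = isqrt (D * (t * t))
  w = M * (r + s + M)
  c = M * (C + D + M)
  r≤Ct : r ≤ C * t
  r≤Ct = isqrt-scaled-≤ C t
  s≤Dt : s ≤ D * t
  s≤Dt = isqrt-scaled-≤ D t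
  w≤ct : w ≤ c * t
  w≤ct = begin
    M * (r + s + M)          ≤⟨ *-monoʳ-≤ M (+-mono-≤ (+-mono-≤ r≤Ct s≤Dt) (m≤m*n M t)) ⟩
    M * (C * t + D * t + M * t) ≡⟨ factor M C D t ⟩
    c * t                    ∎
    where
    factor : ∀ M C D t → M * (C * t + D * t + M * t) ≡ M * (C + D + M) * t
    factor = solve-∀
  regroup : ∀ C D c t → 2 * (C * t * (D * t)) * (c * t) + c * t * (c * t)
                        ≡ 2 * (C * D) * c * (t * t * t) + c * c * (t * t)
  regroup = solve-∀

-- At scale 4ᵏ = t² the gap between the products is at least t⁴, while by
-- rounding-slack-≤ the slack stays below k t³ ≤ t⁴.
sqrt-sum-separation : ∀ {A B C D} m → A + B ≡ C + D → C * D < A * B →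
  ∃[ k ] isqrt (C * 4 ^ k) + isqrt (D * 4 ^ k) + m ≤ isqrt (A * 4 ^ k) + isqrt (B * 4 ^ k)
sqrt-sum-separation {A} {B} {C} {D} m sums≡ CD<AB =
  k , subst Separated (sym (4^n≡2^n*2^n k))
            (isqrt-sum-≤ {A * K} {B * K} {C * K} {D * K} m scaled-sums≡ scaled-products≤)
  where
  open ≤-Reasoning
  M c k t K : ℕ
  M = suc m
  c = M * (C + D + M)
  k = 2 * (C * D) * c + c * c
  t = 2 ^ k
  K = t * t

  Separated : ℕ → Set
  Separated x = isqrt (C * x) + isqrt (D * x) + m ≤ isqrt (A * x) + isqrt (B * x)

  scaled-sums≡ : A * K + B * K ≡ C * K + D * K
  scaled-sums≡ = trans (sym (*-distribʳ-+ K A B)) (trans (cong (_* K) sums≡) (*-distribʳ-+ K C D))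

  t³-dominated : k * (t * t * t) ≤ t * (t * t * t)
  t³-dominated = *-monoˡ-≤ (t * t * t) (<⇒≤ (n<2^n k))

  scaled-products≤ : C * K * (D * K) + _ ≤ A * K * (B * K)
  scaled-products≤ = begin
    C * K * (D * K) + _
      ≤⟨ +-monoʳ-≤ _ (≤-trans (rounding-slack-≤ M C D t {{m^n≢0 2 k}}) t³-dominated) ⟩
    C * K * (D * K) + t * (t * t * t) ≡⟨ regroup C D t ⟩
    suc (C * D) * (K * K)           ≤⟨ *-monoˡ-≤ (K * K) CD<AB ⟩
    A * B * (K * K)                 ≡⟨ square-scaled A B K ⟩
    A * K * (B * K)                 ∎
    where
    regroup : ∀ C D t → C * (t * t) * (D * (t * t)) + t * (t * t * t) ≡ (1 + C * D) * ((t * t) * (t * t))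
    regroup = solve-∀
    square-scaled : ∀ A B K → A * B * (K * K) ≡ A * K * (B * K)
    square-scaled = solve-∀

rearrangement : ∀ {x y u v} → x < y → u < v → x * v + y * u < x * u + y * v
rearrangement {x} {u = u} x<y u<v with m≤n⇒∃[o]m+o≡n x<y | m≤n⇒∃[o]m+o≡n u<v
... | i , refl | j , refl =
  subst (suc (x * (suc u + j) + (suc x + i) * u) ≤_) (gap x u i j) (m≤m+n _ (i + j + i * j))
  where
  gap : ∀ x u i j → suc (x * (suc u + j) + (suc x + i) * u) + (i + j + i * j)
                    ≡ x * u + (suc x + i) * (suc u + j)
  gap = solve-∀

switch-radicands-< : ∀ {a b c e} → a < e → c < b →
  (a * a + c * c) * (b * b + e * e) < (a * a + b * b) * (c * c + e * e)
switch-radicands-< {a} {b} {c} {e} a<e c<b = begin-strict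
  (u + x) * (y + v)              ≡⟨ expandˡ u x y v ⟩
  u * v + x * y + (x * v + y * u)
    <⟨ +-monoʳ-< (u * v + x * y) (rearrangement (*-mono-< c<b c<b) (*-mono-< a<e a<e)) ⟩
  u * v + x * y + (x * u + y * v) ≡⟨ expandʳ u x y v ⟩
  (u + y) * (x + v)              ∎
  where
  open ≤-Reasoning
  u v x y : ℕ
  u = a * a
  v = e * e
  x = c * c
  y = b * b
  expandˡ : ∀ u x y v → (u + x) * (y + v) ≡ u * v + x * y + (x * v + y * u)
  expandˡ = solve-∀
  expandʳ : ∀ u x y v → u * v + x * y + (x * u + y * v) ≡ (u + y) * (x + v)
  expandʳ = solve-∀

somborTerm : ℕ → ℕ → ℕ → ℕ
somborTerm k x y = isqrt ((x * x + y * y) * 4 ^ k)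

switch-gain : ∀ {a b c e} m → a < e → c < b →
  ∃[ k ] somborTerm k a c + somborTerm k b e + m ≤ somborTerm k a b + somborTerm k c e
switch-gain {a} {b} {c} {e} m a<e c<b =
  sqrt-sum-separation {a * a + b * b} {c * c + e * e} {a * a + c * c} {b * b + e * e} m
    (+-interchange (a * a) (b * b) (c * c) (e * e)) (switch-radicands-< a<e c<b)

somborTerm-sym : ∀ k x y → somborTerm k x y ≡ somborTerm k y x
somborTerm-sym k x y = cong (λ a → isqrt (a * 4 ^ k)) (+-comm (x * x) (y * y))

sum-tabulate : ∀ {n} (f : Fin n → ℕ) → List.sum (tabulate f) ≡ ∑[ v < n ] f v
sum-tabulate {zero}  f = refl
sum-tabulate {suc n} f = cong (f Fin.zero +_) (sum-tabulate (f ∘ Fin.suc))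

sum-allFin : ∀ {n} (f : Fin n → ℕ) → List.sum (map f (allFin n)) ≡ ∑[ v < n ] f v
sum-allFin f = trans (cong List.sum (map-tabulate id f)) (sum-tabulate f)

sum-concatMap : ∀ {A B : Set} (h : A → ℕ) (F : B → List A) xs →
  List.sum (map h (concatMap F xs)) ≡ List.sum (map (λ x → List.sum (map h (F x))) xs)
sum-concatMap h F []       = refl
sum-concatMap h F (x ∷ xs) = begin
  List.sum (map h (F x ++ concatMap F xs))
    ≡⟨ cong List.sum (map-++ h (F x) (concatMap F xs)) ⟩
  List.sum (map h (F x) ++ map h (concatMap F xs))
    ≡⟨ sum-++ (map h (F x)) (map h (concatMap F xs)) ⟩
  List.sum (map h (F x)) + List.sum (map h (concatMap F xs))
    ≡⟨ cong (List.sum (map h (F x)) +_) (sum-concatMap h F xs) ⟩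
  List.sum (map h (F x)) + List.sum (map (λ x → List.sum (map h (F x))) xs)
    ∎
  where open ≡-Reasoning

∑-zero : ∀ {n} {f : Fin n → ℕ} → (∀ v → f v ≡ 0) → ∑[ v < n ] f v ≡ 0
∑-zero {n} f≡0 = trans (sum-cong-≗ f≡0) (sum-replicate-zero n)

∑-point : ∀ {n} {f : Fin n → ℕ} x → (∀ v → v ≢ x → f v ≡ 0) → ∑[ v < n ] f v ≡ f x
∑-point {suc n} {f} x f≡0 = begin
  ∑[ v < suc n ] f v                 ≡⟨ sum-remove {i = x} f ⟩
  f x + ∑[ j < n ] f (punchIn x j)   ≡⟨ cong (f x +_) (∑-zero (λ j → f≡0 _ (punchInᵢ≢i x j))) ⟩
  f x + 0                            ≡⟨ +-identityʳ (f x) ⟩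
  f x                                ∎
  where open ≡-Reasoning

∑-two-points : ∀ {n} {f : Fin n → ℕ} {x y} → x ≢ y → (∀ v → v ≢ x → v ≢ y → f v ≡ 0) →
  ∑[ v < n ] f v ≡ f x + f y
∑-two-points {suc n} {f} {x} {y} x≢y f≡0 = begin
  ∑[ v < suc n ] f v                 ≡⟨ sum-remove {i = x} f ⟩
  f x + ∑[ j < n ] f (punchIn x j)   ≡⟨ cong (f x +_) (∑-point (punchOut x≢y) off-y) ⟩
  f x + f (punchIn x (punchOut x≢y)) ≡⟨ cong (λ v → f x + f v) (punchIn-punchOut x≢y) ⟩
  f x + f y                          ∎
  where
  open ≡-Reasoning
  off-y : ∀ j → j ≢ punchOut x≢y → f (punchIn x j) ≡ 0
  off-y j j≢ = f≡0 _ (punchInᵢ≢i x j) λ eq →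
    j≢ (punchIn-injective x j _ (trans eq (sym (punchIn-punchOut x≢y))))

infix 8 [_]×_

[_]×_ : Bool → ℕ → ℕ
[ b ]× c = if b then c else 0

sum-if : ∀ {A : Set} (h : A → ℕ) b p → List.sum (map h (if b then p ∷ [] else [])) ≡ [ b ]× h p
sum-if h true  p = +-identityʳ (h p)
sum-if h false p = refl

[xor]×-⊆ : ∀ a b c → (T b → T a) → [ a xor b ]× c + [ b ]× c ≡ [ a ]× c
[xor]×-⊆ true  true  c _   = refl
[xor]×-⊆ true  false c _   = +-identityʳ c
[xor]×-⊆ false true  c b⇒a = ⊥-elim (b⇒a _)
[xor]×-⊆ false false c _   = refl

[xor]×-disjoint : ∀ a b c → (T b → ¬ T a) → [ a xor b ]× c ≡ [ a ]× c + [ b ]× c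
[xor]×-disjoint true  true  c b⇒¬a = ⊥-elim (b⇒¬a _ _)
[xor]×-disjoint true  false c _    = sym (+-identityʳ c)
[xor]×-disjoint false true  c _    = refl
[xor]×-disjoint false false c _    = refl

[<ᵇ]×-total : ∀ {a b} → a ≢ b → ∀ p → [ a <ᵇ b ]× p + [ b <ᵇ a ]× p ≡ p
[<ᵇ]×-total {zero}  {zero}  0≢0 p = ⊥-elim (0≢0 refl)
[<ᵇ]×-total {zero}  {suc b} _   p = +-identityʳ p
[<ᵇ]×-total {suc a} {zero}  _   p = refl
[<ᵇ]×-total {suc a} {suc b} a≢b p = [<ᵇ]×-total (a≢b ∘ cong suc) p

[T]× : ∀ b c → T b → [ b ]× c ≡ c
[T]× true c _ = refl

[¬T]× : ∀ b c → ¬ T b → [ b ]× c ≡ 0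
[¬T]× true  c ¬b = ⊥-elim (¬b _)
[¬T]× false c _  = refl

[∧]× : ∀ a b c → [ a ∧ b ]× c ≡ [ a ]× ([ b ]× c)
[∧]× true  b c = refl
[∧]× false b c = refl

T-xor⁻ : ∀ a b → T (a xor b) → (T a × ¬ T b) ⊎ (¬ T a × T b)
T-xor⁻ true  false _ = inj₁ (_ , λ ())
T-xor⁻ false true  _ = inj₂ ((λ ()) , _)

T-xor⁺ˡ : ∀ a b → T a → ¬ T b → T (a xor b)
T-xor⁺ˡ true true  _ ¬b = ¬b _
T-xor⁺ˡ true false _ _  = _

T-xor⁺ʳ : ∀ a b → ¬ T a → T b → T (a xor b)
T-xor⁺ʳ true  true ¬a _ = ¬a _
T-xor⁺ʳ false true _  _ = _

does-cong : ∀ {A B : Set} (a? : Dec A) (b? : Dec B) → (A → B) → (B → A) → does a? ≡ does b?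
does-cong (yes _) (yes _) _   _   = refl
does-cong (yes a) (no ¬b) a→b _   = ⊥-elim (¬b (a→b a))
does-cong (no ¬a) (yes b) _   b→a = ⊥-elim (¬a (b→a b))
does-cong (no _)  (no _)  _   _   = refl

T-does⁻ : ∀ {A : Set} (a? : Dec A) → T (does a?) → A
T-does⁻ (yes a) _ = a

T-does⁺ : ∀ {A : Set} (a? : Dec A) → A → T (does a?)
T-does⁺ (yes _) _ = _
T-does⁺ (no ¬a) a = ¬a a

-- Edge sets: symmetric difference and single edges

module _ {n : ℕ} where

  Adj-sym : ∀ (G : Graph n) {u v} → Adj G u v → Adj G v u
  Adj-sym G {u} {v} = subst T (symm G u v)

  Adj⇒≢ : ∀ (G : Graph n) {u v} → Adj G u v → u ≢ v
  Adj⇒≢ G {u} a refl = subst T (irrefl G u) a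

  _⊆ᴳ_ : Graph n → Graph n → Set
  X ⊆ᴳ G = ∀ {u v} → Adj X u v → Adj G u v

  EdgeDisjoint : Graph n → Graph n → Set
  EdgeDisjoint X G = ∀ {u v} → Adj X u v → ¬ Adj G u v

  rowSum : Graph n → Fin n → (Fin n → ℕ) → ℕ
  rowSum G u w = ∑[ v < n ] ([ adj G u v ]× w v)

  -- Each edge is counted once, from its endpoint with the smaller index.
  edgeSum : Graph n → (Fin n → Fin n → ℕ) → ℕ
  edgeSum G w = ∑[ u < n ] rowSum G u (λ v → [ toℕ u <ᵇ toℕ v ]× w u v)

  deg≡rowSum : ∀ G u → deg G u ≡ rowSum G u (λ _ → 1)
  deg≡rowSum G u = sum-allFin (λ v → [ adj G u v ]× 1)

  edgeSum-cong : ∀ G {w w′ : Fin n → Fin n → ℕ} → (∀ u v → w u v ≡ w′ u v) → edgeSum G w ≡ edgeSum G w′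
  edgeSum-cong G w≗w′ = sum-cong-≗ λ u → sum-cong-≗ λ v →
    cong (λ c → [ adj G u v ]× ([ toℕ u <ᵇ toℕ v ]× c)) (w≗w′ u v)

  infixl 6 _⊕_

  -- Kept opaque so that adjacency in G ⊕ X and in edge x y stays neutral and the
  -- implicit graphs and vertices of the lemmas below can be inferred.
  opaque
    _⊕_ : Graph n → Graph n → Graph n
    G ⊕ X = record
      { adj    = λ u v → adj G u v xor adj X u v
      ; symm   = λ u v → cong₂ _xor_ (symm G u v) (symm X u v)
      ; irrefl = λ u → cong₂ _xor_ (irrefl G u) (irrefl X u)
      }

    ⊕-elim : ∀ {G X : Graph n} {u v} → Adj (G ⊕ X) u v →
      (Adj G u v × ¬ Adj X u v) ⊎ (¬ Adj G u v × Adj X u v)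
    ⊕-elim {G} {X} {u} {v} = T-xor⁻ (adj G u v) (adj X u v)

    ⊕-introˡ : ∀ {G X : Graph n} {u v} → Adj G u v → ¬ Adj X u v → Adj (G ⊕ X) u v
    ⊕-introˡ {G} {X} {u} {v} = T-xor⁺ˡ (adj G u v) (adj X u v)

    ⊕-introʳ : ∀ {G X : Graph n} {u v} → ¬ Adj G u v → Adj X u v → Adj (G ⊕ X) u v
    ⊕-introʳ {G} {X} {u} {v} = T-xor⁺ʳ (adj G u v) (adj X u v)

    rowSum-⊕-⊆ : ∀ {G X} → X ⊆ᴳ G → ∀ u w → rowSum (G ⊕ X) u w + rowSum X u w ≡ rowSum G u w
    rowSum-⊕-⊆ {G} {X} X⊆G u w =
      trans (sym (∑-distrib-+ (λ v → [ adj (G ⊕ X) u v ]× w v) (λ v → [ adj X u v ]× w v)))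
      (sum-cong-≗ λ v → [xor]×-⊆ (adj G u v) (adj X u v) (w v) (X⊆G {u} {v}))

    rowSum-⊕-disjoint : ∀ {G X} → EdgeDisjoint X G → ∀ u w →
      rowSum (G ⊕ X) u w ≡ rowSum G u w + rowSum X u w
    rowSum-⊕-disjoint {G} {X} X∩G=∅ u w = trans
      (sum-cong-≗ λ v → [xor]×-disjoint (adj G u v) (adj X u v) (w v) (X∩G=∅ {u} {v}))
      (∑-distrib-+ (λ v → [ adj G u v ]× w v) (λ v → [ adj X u v ]× w v))

  ⊕⇒⊎ : ∀ {G X : Graph n} {u v} → Adj (G ⊕ X) u v → Adj G u v ⊎ Adj X u v
  ⊕⇒⊎ {G} {X} g⊕x with ⊕-elim g⊕x
  ... | inj₁ (g , _) = inj₁ g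
  ... | inj₂ (_ , x) = inj₂ x

  ⊕-⊆ : ∀ {G X : Graph n} → X ⊆ᴳ G → (G ⊕ X) ⊆ᴳ G
  ⊕-⊆ {G} {X} X⊆G g⊕x with ⊕-elim g⊕x
  ... | inj₁ (g , _)  = g
  ... | inj₂ (¬g , x) = ⊥-elim (¬g (X⊆G x))

  ⊕-disjoint-introˡ : ∀ {G X : Graph n} → EdgeDisjoint X G → ∀ {u v} → Adj G u v → Adj (G ⊕ X) u v
  ⊕-disjoint-introˡ {G} {X} X∩G=∅ g = ⊕-introˡ g (λ x → X∩G=∅ x g)

  ⊕-disjoint-introʳ : ∀ {G X : Graph n} → EdgeDisjoint X G → ∀ {u v} → Adj X u v → Adj (G ⊕ X) u v
  ⊕-disjoint-introʳ {G} {X} X∩G=∅ x = ⊕-introʳ (X∩G=∅ x) x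

  deg-⊕-⊆ : ∀ {G X} → X ⊆ᴳ G → ∀ u → deg (G ⊕ X) u + deg X u ≡ deg G u
  deg-⊕-⊆ {G} {X} X⊆G u = begin
    deg (G ⊕ X) u + deg X u                         ≡⟨ cong₂ _+_ (deg≡rowSum (G ⊕ X) u) (deg≡rowSum X u) ⟩
    rowSum (G ⊕ X) u (λ _ → 1) + rowSum X u (λ _ → 1) ≡⟨ rowSum-⊕-⊆ X⊆G u (λ _ → 1) ⟩
    rowSum G u (λ _ → 1)                            ≡⟨ deg≡rowSum G u ⟨
    deg G u                                         ∎
    where open ≡-Reasoning

  deg-⊕-disjoint : ∀ {G X} → EdgeDisjoint X G → ∀ u → deg (G ⊕ X) u ≡ deg G u + deg X u
  deg-⊕-disjoint {G} {X} X∩G=∅ u = begin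
    deg (G ⊕ X) u                                   ≡⟨ deg≡rowSum (G ⊕ X) u ⟩
    rowSum (G ⊕ X) u (λ _ → 1)                      ≡⟨ rowSum-⊕-disjoint X∩G=∅ u (λ _ → 1) ⟩
    rowSum G u (λ _ → 1) + rowSum X u (λ _ → 1)     ≡⟨ cong₂ _+_ (deg≡rowSum G u) (deg≡rowSum X u) ⟨
    deg G u + deg X u                               ∎
    where open ≡-Reasoning

  edgeSum-⊕-⊆ : ∀ {G X} → X ⊆ᴳ G → ∀ w → edgeSum (G ⊕ X) w + edgeSum X w ≡ edgeSum G w
  edgeSum-⊕-⊆ {G} {X} X⊆G w =
    trans (sym (∑-distrib-+ (λ u → rowSum (G ⊕ X) u (w′ u)) (λ u → rowSum X u (w′ u))))
    (sum-cong-≗ λ u → rowSum-⊕-⊆ X⊆G u (w′ u))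
    where
    w′ : Fin n → Fin n → ℕ
    w′ u v = [ toℕ u <ᵇ toℕ v ]× w u v

  edgeSum-⊕-disjoint : ∀ {G X} → EdgeDisjoint X G → ∀ w → edgeSum (G ⊕ X) w ≡ edgeSum G w + edgeSum X w
  edgeSum-⊕-disjoint {G} {X} X∩G=∅ w = trans (sum-cong-≗ λ u → rowSum-⊕-disjoint X∩G=∅ u (w′ u))
    (∑-distrib-+ (λ u → rowSum G u (w′ u)) (λ u → rowSum X u (w′ u)))
    where
    w′ : Fin n → Fin n → ℕ
    w′ u v = [ toℕ u <ᵇ toℕ v ]× w u v

  SameEdge : Fin n → Fin n → Fin n → Fin n → Set
  SameEdge x y u v = (u ≡ x × v ≡ y) ⊎ (u ≡ y × v ≡ x)

  sameEdge? : ∀ x y u v → Dec (SameEdge x y u v)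
  sameEdge? x y u v = (u ≟ x ×-dec v ≟ y) ⊎-dec (u ≟ y ×-dec v ≟ x)

  SameEdge-flip : ∀ {x y u v} → SameEdge x y u v → SameEdge x y v u
  SameEdge-flip (inj₁ (u≡x , v≡y)) = inj₂ (v≡y , u≡x)
  SameEdge-flip (inj₂ (u≡y , v≡x)) = inj₁ (v≡x , u≡y)

  SameEdge-swap : ∀ {x y u v} → SameEdge x y u v → SameEdge y x u v
  SameEdge-swap (inj₁ p) = inj₂ p
  SameEdge-swap (inj₂ p) = inj₁ p

  ¬SameEdge-endpoint : ∀ {z w a b} → a ≢ z → b ≢ z → ¬ SameEdge z w a b
  ¬SameEdge-endpoint a≢z _   (inj₁ (a≡z , _)) = a≢z a≡z
  ¬SameEdge-endpoint _   b≢z (inj₂ (_ , b≡z)) = b≢z b≡z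

  opaque
    edge : (x y : Fin n) → x ≢ y → Graph n
    edge x y x≢y = record
      { adj    = λ u v → does (sameEdge? x y u v)
      ; symm   = λ u v → does-cong (sameEdge? x y u v) (sameEdge? x y v u) SameEdge-flip SameEdge-flip
      ; irrefl = λ u → dec-false (sameEdge? x y u u) λ where
          (inj₁ (refl , refl)) → x≢y refl
          (inj₂ (refl , refl)) → x≢y refl
      }

    edge-elim : ∀ {x y x≢y u v} → Adj (edge x y x≢y) u v → SameEdge x y u v
    edge-elim {x} {y} {_} {u} {v} = T-does⁻ (sameEdge? x y u v)

    edge-intro : ∀ {x y x≢y u v} → SameEdge x y u v → Adj (edge x y x≢y) u v
    edge-intro {x} {y} {_} {u} {v} = T-does⁺ (sameEdge? x y u v)

  edge-disjoint : ∀ {x y z w x≢y z≢w} → z ≢ x → z ≢ y → EdgeDisjoint (edge z w z≢w) (edge x y x≢y)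
  edge-disjoint {x} {y} {z} {w} {x≢y} {z≢w} z≢x z≢y {u} {v} zw xy
    with edge-elim zw | edge-elim xy
  ... | inj₁ (refl , _) | inj₁ (refl , _) = z≢x refl
  ... | inj₁ (refl , _) | inj₂ (refl , _) = z≢y refl
  ... | inj₂ (_ , refl) | inj₁ (_ , refl) = z≢y refl
  ... | inj₂ (_ , refl) | inj₂ (_ , refl) = z≢x refl

  module _ {x y : Fin n} (x≢y : x ≢ y) where

    [edge]×-on : ∀ {u v} c → SameEdge x y u v → [ adj (edge x y x≢y) u v ]× c ≡ c
    [edge]×-on {u} {v} c e = [T]× (adj (edge x y x≢y) u v) c (edge-intro e)

    [edge]×-off : ∀ {u v} c → ¬ SameEdge x y u v → [ adj (edge x y x≢y) u v ]× c ≡ 0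
    [edge]×-off {u} {v} c ¬e = [¬T]× (adj (edge x y x≢y) u v) c (¬e ∘ edge-elim)

    rowSum-edge-left : ∀ f → rowSum (edge x y x≢y) x f ≡ f y
    rowSum-edge-left f = trans (∑-point y λ v v≢y → [edge]×-off (f v) λ where
        (inj₁ (_ , v≡y)) → v≢y v≡y
        (inj₂ (x≡y , _)) → x≢y x≡y)
      ([edge]×-on (f y) (inj₁ (refl , refl)))

    rowSum-edge-right : ∀ f → rowSum (edge x y x≢y) y f ≡ f x
    rowSum-edge-right f = trans (∑-point x λ v v≢x → [edge]×-off (f v) λ where
        (inj₁ (y≡x , _)) → x≢y (sym y≡x)
        (inj₂ (_ , v≡x)) → v≢x v≡x)
      ([edge]×-on (f x) (inj₂ (refl , refl)))

    rowSum-edge-off : ∀ {u} f → u ≢ x → u ≢ y → rowSum (edge x y x≢y) u f ≡ 0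
    rowSum-edge-off {u} f u≢x u≢y = ∑-zero λ v → [edge]×-off (f v) λ where
      (inj₁ (u≡x , _)) → u≢x u≡x
      (inj₂ (u≡y , _)) → u≢y u≡y

    edgeSum-edge : ∀ w → (∀ u v → w u v ≡ w v u) → edgeSum (edge x y x≢y) w ≡ w x y
    edgeSum-edge w w-sym = begin
      edgeSum (edge x y x≢y) w
        ≡⟨ ∑-two-points x≢y (λ u u≢x u≢y → rowSum-edge-off _ u≢x u≢y) ⟩
      rowSum (edge x y x≢y) x _ + rowSum (edge x y x≢y) y _
        ≡⟨ cong₂ _+_ (rowSum-edge-left _) (rowSum-edge-right _) ⟩
      [ toℕ x <ᵇ toℕ y ]× w x y + [ toℕ y <ᵇ toℕ x ]× w y x
        ≡⟨ cong (λ c → [ toℕ x <ᵇ toℕ y ]× w x y + [ toℕ y <ᵇ toℕ x ]× c) (w-sym y x) ⟩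
      [ toℕ x <ᵇ toℕ y ]× w x y + [ toℕ y <ᵇ toℕ x ]× w x y
        ≡⟨ [<ᵇ]×-total (x≢y ∘ toℕ-injective) (w x y) ⟩
      w x y
        ∎
      where open ≡-Reasoning

  deg-edge : ∀ {x y} (x≢y : x ≢ y) u → deg (edge x y x≢y) u ≡ [ does (u ≟ x) ]× 1 + [ does (u ≟ y) ]× 1
  deg-edge {x} {y} x≢y u = trans (deg≡rowSum (edge x y x≢y) u) (rowSum-edge-1 x≢y u (u ≟ x) (u ≟ y))
    where
    rowSum-edge-1 : ∀ {x y} (x≢y : x ≢ y) u (u≟x : Dec (u ≡ x)) (u≟y : Dec (u ≡ y)) →
      rowSum (edge x y x≢y) u (λ _ → 1) ≡ [ does u≟x ]× 1 + [ does u≟y ]× 1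
    rowSum-edge-1 x≢y u (yes refl) (yes refl) = ⊥-elim (x≢y refl)
    rowSum-edge-1 x≢y u (yes refl) (no _)     = rowSum-edge-left x≢y _
    rowSum-edge-1 x≢y u (no _)     (yes refl) = rowSum-edge-right x≢y _
    rowSum-edge-1 x≢y u (no u≢x)   (no u≢y)   = rowSum-edge-off x≢y _ u≢x u≢y

-- Walks, bridges and cycles

module _ {n : ℕ} where

  open DecMembership (_≟_ {n}) using (_∈?_)

  Within : (Fin n → Set) → Rel (Fin n) 0ℓ → Rel (Fin n) 0ℓ
  Within P R a b = R a b × P a × P b

  Without : Rel (Fin n) 0ℓ → Fin n → Fin n → Rel (Fin n) 0ℓ
  Without R x y a b = R a b × ¬ SameEdge x y a b

  IsBridge : Rel (Fin n) 0ℓ → Fin n → Fin n → Set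
  IsBridge R x y = ¬ Star (Without R x y) x y

  Without-swap : ∀ {R x y a b} → Without R x y a b → Without R y x a b
  Without-swap (r , ¬e) = r , ¬e ∘ SameEdge-swap

  IsBridge-sym : ∀ {R : Rel (Fin n) 0ℓ} → (∀ {a b} → R a b → R b a) →
    ∀ {x y} → IsBridge R x y → IsBridge R y x
  IsBridge-sym {R} R-sym {x} {y} bridge walk =
    bridge (Star.map (Without-swap {R}) (Star.reverse {T = Without R y x} reverse-step walk))
    where
    reverse-step : ∀ {a b} → Without R y x a b → Without R y x b a
    reverse-step (r , ¬e) = R-sym r , ¬e ∘ SameEdge-flip

  Star-preserves : ∀ {R : Rel (Fin n) 0ℓ} (P : Fin n → Set) → (∀ {a b} → R a b → P a → P b) →
    ∀ {x y} → Star R x y → P x → P y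
  Star-preserves P pres ε        px = px
  Star-preserves P pres (r ◅ rs) px = Star-preserves P pres rs (pres r px)

  walk⇒star : ∀ {G : Graph n} {u v} → Walk G u v → Star (Adj G) u v
  walk⇒star here       = ε
  walk⇒star (step a w) = a ◅ walk⇒star w

  star⇒walk : ∀ {G : Graph n} {u v} → Star (Adj G) u v → Walk G u v
  star⇒walk ε        = here
  star⇒walk (a ◅ as) = step a (star⇒walk as)

  Linked⇒Star : ∀ {R : Rel (Fin n) 0ℓ} {P : Fin n → Set} x xs y →
    Linked R (x ∷ xs ++ y ∷ []) → All P (x ∷ xs ++ y ∷ []) → Star (Within P R) x y
  Linked⇒Star x []       y (r ∷ [-]) (px ∷ py ∷ []) = (r , px , py) ◅ ε
  Linked⇒Star x (w ∷ xs) y (r ∷ rs)  (px ∷ pws)     = (r , px , All.head pws) ◅ Linked⇒Star w xs y rs pws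

  Linked-∷ʳ⁻ : ∀ {R : Rel (Fin n) 0ℓ} xs {y z} →
    Linked R (xs ++ y ∷ z ∷ []) → Linked R (xs ++ y ∷ []) × R y z
  Linked-∷ʳ⁻ []           (r ∷ [-]) = [-] , r
  Linked-∷ʳ⁻ (x ∷ [])     (r ∷ rs)  = r ∷ proj₁ (Linked-∷ʳ⁻ [] rs) , proj₂ (Linked-∷ʳ⁻ [] rs)
  Linked-∷ʳ⁻ (x ∷ w ∷ xs) (r ∷ rs)  = r ∷ proj₁ (Linked-∷ʳ⁻ (w ∷ xs) rs) , proj₂ (Linked-∷ʳ⁻ (w ∷ xs) rs)

  All-dropLast : ∀ {P : Fin n → Set} xs {y z} → All P (xs ++ y ∷ z ∷ []) → All P (xs ++ y ∷ [])
  All-dropLast xs ps = All.++⁺ (All.++⁻ˡ xs ps) (All.head (All.++⁻ʳ xs ps) ∷ [])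

  Unique⇒last∉ : ∀ xs {y z : Fin n} → Unique (xs ++ y ∷ z ∷ []) → All (_≢ z) (xs ++ y ∷ [])
  Unique⇒last∉ []       (y∉ ∷ _)  = All.head y∉ ∷ []
  Unique⇒last∉ (x ∷ xs) (x∉ ∷ uq) = All.head (All.tail (All.++⁻ʳ xs x∉)) ∷ Unique⇒last∉ xs uq

  data EndsAt : List (Fin n) → Fin n → Set where
    end : ∀ {y} → EndsAt (y ∷ []) y
    _∷_ : ∀ x {w xs y} → EndsAt (w ∷ xs) y → EndsAt (x ∷ w ∷ xs) y

  EndsAt-∷ʳ : ∀ xs y → EndsAt (xs ++ y ∷ []) y
  EndsAt-∷ʳ []           y = end
  EndsAt-∷ʳ (x ∷ [])     y = x ∷ end
  EndsAt-∷ʳ (x ∷ w ∷ xs) y = x ∷ EndsAt-∷ʳ (w ∷ xs) y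

  Linked-∷ʳ : ∀ {R : Rel (Fin n) 0ℓ} {zs y z} → Linked R zs → EndsAt zs y → R y z → Linked R (zs ++ z ∷ [])
  Linked-∷ʳ [-]      end     r = r ∷ [-]
  Linked-∷ʳ (r′ ∷ rs) (_ ∷ e) r = r′ ∷ Linked-∷ʳ rs e r

  Unique-∷ʳ : ∀ {c} {xs : List (Fin n)} → All (c ≢_) xs → Unique xs → Unique (xs ++ c ∷ [])
  Unique-∷ʳ c∉xs uq = Unique.++⁺ uq ([] ∷ []) λ where
    (v∈xs , here refl) → All.lookup c∉xs v∈xs refl

  record Path (R : Rel (Fin n) 0ℓ) (x y : Fin n) : Set where
    constructor path
    field
      rest   : List (Fin n)
      linked : Linked R (x ∷ rest)
      unique : Unique (x ∷ rest)
      endsAt : EndsAt (x ∷ rest) y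

  suffix-path : ∀ {R : Rel (Fin n) 0ℓ} {x y} zs →
    x ∈ zs → Linked R zs → Unique zs → EndsAt zs y → Path R x y
  suffix-path (z ∷ zs)     (here refl) rs uq       e       = path zs rs uq e
  suffix-path (z ∷ w ∷ ws) (there x∈)  rs (_ ∷ uq) (_ ∷ e) =
    suffix-path (w ∷ ws) x∈ (Linked.tail rs) uq e

  -- Loop erasure: a step whose source reappears later is dropped together with the loop it closes.
  walk⇒path : ∀ {R : Rel (Fin n) 0ℓ} {x y} → Star R x y → Path R x y
  walk⇒path ε = path [] [-] ([] ∷ []) end
  walk⇒path {x = x} (r ◅ rs) with walk⇒path rs
  ... | path ws lk uq e with x ∈? (_ ∷ ws)
  ...   | yes x∈ = suffix-path _ x∈ lk uq e
  ...   | no x∉  = path (_ ∷ ws) (r ∷ lk) (¬Any⇒All¬ _ x∉ ∷ uq) (x ∷ e)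

  acyclic⇒bridge : ∀ {G : Graph n} → Acyclic G → ∀ {x y} → Adj G x y → IsBridge (Adj G) x y
  acyclic⇒bridge {G} acyclic {x} xy walk with walk⇒path walk
  ... | path []           _                 _  end         = Adj⇒≢ G xy refl
  ... | path (_ ∷ [])     ((_ , ¬xy) ∷ _)   _  (_ ∷ end)   = ¬xy (inj₁ (refl , refl))
  ... | path (w ∷ w′ ∷ ws) rs               uq e           =
    acyclic (x ∷ w ∷ w′ ∷ ws) (s≤s (s≤s (s≤s z≤n)) , uq , Linked-∷ʳ (Linked.map proj₁ rs) e (Adj-sym G xy))

  cycle⇒detour : ∀ {G : Graph n} {u v w rest} →
    IsCycle G (u ∷ v ∷ w ∷ rest) → Star (Without (Adj G) u v) v u
  cycle⇒detour {G} {u} {v} {w} {rest} (_ , (u∉ ∷ v∉ ∷ _) , (_ ∷ vw ∷ rs)) = first ◅ Star.map avoid-v walk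
    where
    u≢v : u ≢ v
    u≢v = All.head u∉
    u≢w : u ≢ w
    u≢w = All.head (All.tail u∉)
    first : Without (Adj G) u v v w
    first = vw , λ where
      (inj₁ (v≡u , _)) → u≢v (sym v≡u)
      (inj₂ (_ , w≡u)) → u≢w (sym w≡u)
    -- every later step avoids v, so it cannot be the edge uv
    walk : Star (Within (_≢ v) (Adj G)) w u
    walk = Linked⇒Star w rest u rs (All.++⁺ (All.map (_∘ sym) v∉) (u≢v ∷ []))
    avoid-v : ∀ {a b} → Within (_≢ v) (Adj G) a b → Without (Adj G) u v a b
    avoid-v (r , a≢v , b≢v) = r , λ where
      (inj₁ (_ , b≡v)) → b≢v b≡v
      (inj₂ (a≡v , _)) → a≢v a≡v

  IsCycle-rotate₁ : ∀ {G : Graph n} c cs → IsCycle G (c ∷ cs) → IsCycle G (cs ++ c ∷ [])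
  IsCycle-rotate₁ c []        (s≤s () , _)
  IsCycle-rotate₁ c (c₁ ∷ cs) (3≤len , (c∉ ∷ uq) , (cc₁ ∷ rs)) =
    ≤-trans 3≤len (≤-reflexive (sym (trans (length-++ (c₁ ∷ cs)) (+-comm _ 1)))) ,
    Unique-∷ʳ c∉ uq ,
    Linked-∷ʳ rs (EndsAt-∷ʳ (c₁ ∷ cs) c) cc₁

  IsCycle-rotate : ∀ {G : Graph n} pre ys → IsCycle G (pre ++ ys) → IsCycle G (ys ++ pre)
  IsCycle-rotate {G} []        ys cyc = subst (IsCycle G) (sym (++-identityʳ ys)) cyc
  IsCycle-rotate {G} (p ∷ pre) ys cyc =
    subst (IsCycle G) (++-assoc ys (p ∷ []) pre)
      (IsCycle-rotate {G} pre (ys ++ p ∷ [])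
        (subst (IsCycle G) (++-assoc pre ys (p ∷ [])) (IsCycle-rotate₁ {G} p (pre ++ ys) cyc)))

  record ConsecutiveIn (Q : Rel (Fin n) 0ℓ) (xs : List (Fin n)) : Set where
    constructor consecutive
    field
      pre  : List (Fin n)
      u v  : Fin n
      post : List (Fin n)
      xs≡  : xs ≡ pre ++ u ∷ v ∷ post
      Quv  : Q u v

  Linked-split : ∀ {R : Rel (Fin n) 0ℓ} (Q : Rel (Fin n) 0ℓ) → (∀ u v → Dec (Q u v)) → ∀ xs → Linked R xs →
    Linked (λ u v → R u v × ¬ Q u v) xs ⊎ ConsecutiveIn Q xs
  Linked-split Q Q? []           []       = inj₁ []
  Linked-split Q Q? (x ∷ [])     [-]      = inj₁ [-]
  Linked-split Q Q? (x ∷ y ∷ xs) (r ∷ rs) with Q? x y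
  ... | yes q  = inj₂ (consecutive [] x y xs refl q)
  ... | no ¬q with Linked-split Q Q? (y ∷ xs) rs
  ...   | inj₁ rs′ = inj₁ ((r , ¬q) ∷ rs′)
  ...   | inj₂ (consecutive pre u v post eq q) = inj₂ (consecutive (x ∷ pre) u v post (cong (x ∷_) eq) q)

  cycle-from-edge : ∀ {G : Graph n} {xs pre u v post} → IsCycle G xs →
    xs ++ take 1 xs ≡ pre ++ u ∷ v ∷ post → ∃[ rest ] IsCycle G (u ∷ v ∷ rest)
  cycle-from-edge {G} {[]} (() , _)
  cycle-from-edge {G} {c ∷ cs} {pre} {u} {v} {post} cyc eq with initLast post
  ... | [] with ∷ʳ-injective (c ∷ cs) (pre ++ u ∷ []) (trans eq (sym (++-assoc pre (u ∷ []) (v ∷ []))))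
  ...   | cs≡ , refl with pre
  ...     | []       = case subst (IsCycle G) cs≡ cyc of λ { (s≤s () , _) }
  ...     | p ∷ pre′ = pre′ , subst (λ p → IsCycle G (u ∷ p ∷ pre′)) (sym (∷-injectiveˡ cs≡))
                                 (IsCycle-rotate {G} (p ∷ pre′) (u ∷ []) (subst (IsCycle G) cs≡ cyc))
  cycle-from-edge {G} {c ∷ cs} {pre} {u} {v} cyc eq | post′ ∷ʳ′ z =
    post′ ++ pre , IsCycle-rotate {G} pre (u ∷ v ∷ post′) (subst (IsCycle G) xs≡ cyc)
    where
    xs≡ : c ∷ cs ≡ pre ++ u ∷ v ∷ post′
    xs≡ = proj₁ (∷ʳ-injective (c ∷ cs) (pre ++ u ∷ v ∷ post′)
                  (trans eq (sym (++-assoc pre (u ∷ v ∷ post′) (z ∷ [])))))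

  -- A cycle has an edge outside the forest G; rotated to the front, it is not a bridge.
  acyclic-by-bridges : ∀ {G H X : Graph n} → Acyclic G →
    (∀ {u v} → Adj H u v → ¬ Adj X u v → Adj G u v) →
    (∀ {u v} → Adj X u v → IsBridge (Adj H) u v) → Acyclic H
  acyclic-by-bridges {G} {H} {X} acyclic H∖X⊆G bridge xs cyc@(3≤len , uq , rs)
    with Linked-split (λ u v → Adj X u v) (λ u v → T? (adj X u v)) _ rs
  ... | inj₁ rs′ = acyclic xs (3≤len , uq , Linked.map (λ (h , ¬x) → H∖X⊆G h ¬x) rs′)
  ... | inj₂ (consecutive pre u v post eq x) with cycle-from-edge {H} cyc eq
  ...   | []       , (s≤s (s≤s ()) , _)
  ...   | (_ ∷ _)  , cyc′ = bridge (Adj-sym X x) (Star.map (Without-swap {Adj H}) (cycle⇒detour {H} cyc′))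

module _ {n : ℕ} where

  SOₖ : ℕ → Graph n → ℕ
  SOₖ k G = List.sum (map (λ a → isqrt (a * 4 ^ k)) (somborRadicands G))

  SOₖ≡edgeSum : ∀ k (G : Graph n) → SOₖ k G ≡ edgeSum G (λ u v → somborTerm k (deg G u) (deg G v))
  SOₖ≡edgeSum k G = begin
    SOₖ k G                                           ≡⟨ cong List.sum (map-∘ (edges G)) ⟨
    List.sum (map term (edges G))                     ≡⟨ sum-concatMap term row (allFin n) ⟩
    List.sum (map (List.sum ∘ map term ∘ row) (allFin n)) ≡⟨ sum-allFin (List.sum ∘ map term ∘ row) ⟩
    ∑[ u < n ] List.sum (map term (row u))            ≡⟨ sum-cong-≗ row-sum ⟩
    edgeSum G ψ                                       ∎
    where
    open ≡-Reasoning
    ψ : Fin n → Fin n → ℕ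
    ψ u v = somborTerm k (deg G u) (deg G v)
    term : Fin n × Fin n → ℕ
    term (u , v) = ψ u v
    cell : Fin n → Fin n → List (Fin n × Fin n)
    cell u v = if adj G u v ∧ (toℕ u <ᵇ toℕ v) then (u , v) ∷ [] else []
    row : Fin n → List (Fin n × Fin n)
    row u = concatMap (cell u) (allFin n)
    row-sum : ∀ u → List.sum (map term (row u)) ≡ rowSum G u (λ v → [ toℕ u <ᵇ toℕ v ]× ψ u v)
    row-sum u = begin
      List.sum (map term (row u))
        ≡⟨ sum-concatMap term (cell u) (allFin n) ⟩
      List.sum (map (List.sum ∘ map term ∘ cell u) (allFin n))
        ≡⟨ sum-allFin (List.sum ∘ map term ∘ cell u) ⟩
      ∑[ v < n ] List.sum (map term (cell u v))
        ≡⟨ sum-cong-≗ (λ v → trans (sum-if term _ (u , v)) ([∧]× (adj G u v) _ _)) ⟩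
      rowSum G u (λ v → [ toℕ u <ᵇ toℕ v ]× ψ u v)
        ∎

-- The two-switch along a path

module _ {n : ℕ} where

  Away : Fin n → Fin n → Fin n → Set
  Away x y a = a ≢ x × a ≢ y

  record SwitchPath (G : Graph n) (v₁ v₂ v₃ v₄ : Fin n) : Set where
    field
      v₁v₂∈G : Adj G v₁ v₂
      v₃v₄∈G : Adj G v₃ v₄
      inner  : Star (Within (Away v₁ v₄) (Adj G)) v₂ v₃
      v₁≢v₃  : v₁ ≢ v₃
      v₁≢v₄  : v₁ ≢ v₄
      v₂≢v₃  : v₂ ≢ v₃
      v₂≢v₄  : v₂ ≢ v₄

  module TwoSwitch {G : Graph n} (tree : IsTree G) {v₁ v₂ v₃ v₄} (p : SwitchPath G v₁ v₂ v₃ v₄) where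
    open SwitchPath p

    connected : Connected G
    connected = proj₁ tree

    acyclic : Acyclic G
    acyclic = proj₂ tree

    G-bridge : ∀ {x y} → Adj G x y → IsBridge (Adj G) x y
    G-bridge = acyclic⇒bridge {G = G} acyclic

    v₁≢v₂ : v₁ ≢ v₂
    v₁≢v₂ = Adj⇒≢ G v₁v₂∈G

    v₃≢v₄ : v₃ ≢ v₄
    v₃≢v₄ = Adj⇒≢ G v₃v₄∈G

    v₁v₃∉G : ¬ Adj G v₁ v₃
    v₁v₃∉G v₁v₃ = G-bridge v₁v₃ (first ◅ Star.map avoid inner)
      where
      first : Without (Adj G) v₁ v₃ v₁ v₂
      first = v₁v₂∈G , λ where
        (inj₁ (_ , v₂≡v₃)) → v₂≢v₃ v₂≡v₃
        (inj₂ (v₁≡v₃ , _)) → v₁≢v₃ v₁≡v₃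
      avoid : ∀ {a b} → Within (Away v₁ v₄) (Adj G) a b → Without (Adj G) v₁ v₃ a b
      avoid (g , (a≢v₁ , _) , (b≢v₁ , _)) = g , ¬SameEdge-endpoint a≢v₁ b≢v₁

    v₂v₄∉G : ¬ Adj G v₂ v₄
    v₂v₄∉G v₂v₄ = G-bridge v₂v₄ (Star.map avoid inner ◅◅ (last ◅ ε))
      where
      last : Without (Adj G) v₂ v₄ v₃ v₄
      last = v₃v₄∈G , λ where
        (inj₁ (v₃≡v₂ , _)) → v₂≢v₃ (sym v₃≡v₂)
        (inj₂ (v₃≡v₄ , _)) → v₃≢v₄ v₃≡v₄
      avoid : ∀ {a b} → Within (Away v₁ v₄) (Adj G) a b → Without (Adj G) v₂ v₄ a b
      avoid (g , (_ , a≢v₄) , (_ , b≢v₄)) = g , ¬SameEdge-endpoint a≢v₄ b≢v₄ ∘ SameEdge-swap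

    e₁₂ e₃₄ e₁₃ e₂₄ : Graph n
    e₁₂ = edge v₁ v₂ v₁≢v₂
    e₃₄ = edge v₃ v₄ v₃≢v₄
    e₁₃ = edge v₁ v₃ v₁≢v₃
    e₂₄ = edge v₂ v₄ v₂≢v₄

    removed added switched : Graph n
    removed  = e₁₂ ⊕ e₃₄
    added    = e₁₃ ⊕ e₂₄
    switched = G ⊕ removed ⊕ added

    removed-disjoint : EdgeDisjoint e₃₄ e₁₂
    removed-disjoint = edge-disjoint (v₁≢v₃ ∘ sym) (v₂≢v₃ ∘ sym)

    added-disjoint : EdgeDisjoint e₂₄ e₁₃
    added-disjoint = edge-disjoint (v₁≢v₂ ∘ sym) v₂≢v₃

    removed-elim : ∀ {u v} → Adj removed u v → SameEdge v₁ v₂ u v ⊎ SameEdge v₃ v₄ u v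
    removed-elim r = [ inj₁ ∘ edge-elim , inj₂ ∘ edge-elim ]′ (⊕⇒⊎ r)

    added-elim : ∀ {u v} → Adj added u v → SameEdge v₁ v₃ u v ⊎ SameEdge v₂ v₄ u v
    added-elim a = [ inj₁ ∘ edge-elim , inj₂ ∘ edge-elim ]′ (⊕⇒⊎ a)

    added-intro : ∀ {u v} → SameEdge v₁ v₃ u v ⊎ SameEdge v₂ v₄ u v → Adj added u v
    added-intro (inj₁ e) = ⊕-disjoint-introˡ added-disjoint (edge-intro e)
    added-intro (inj₂ e) = ⊕-disjoint-introʳ added-disjoint (edge-intro e)

    removed⊆G : removed ⊆ᴳ G
    removed⊆G {u} {v} r with removed-elim r
    ... | inj₁ (inj₁ (refl , refl)) = v₁v₂∈G
    ... | inj₁ (inj₂ (refl , refl)) = Adj-sym G v₁v₂∈G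
    ... | inj₂ (inj₁ (refl , refl)) = v₃v₄∈G
    ... | inj₂ (inj₂ (refl , refl)) = Adj-sym G v₃v₄∈G

    added∩G=∅ : EdgeDisjoint added G
    added∩G=∅ {u} {v} a with added-elim a
    ... | inj₁ (inj₁ (refl , refl)) = v₁v₃∉G
    ... | inj₁ (inj₂ (refl , refl)) = v₁v₃∉G ∘ Adj-sym G
    ... | inj₂ (inj₁ (refl , refl)) = v₂v₄∉G
    ... | inj₂ (inj₂ (refl , refl)) = v₂v₄∉G ∘ Adj-sym G

    added∩G⊕removed=∅ : EdgeDisjoint added (G ⊕ removed)
    added∩G⊕removed=∅ a = added∩G=∅ a ∘ ⊕-⊆ removed⊆G

    deg-removed≡deg-added : ∀ u → deg removed u ≡ deg added u
    deg-removed≡deg-added u = begin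
      deg removed u                 ≡⟨ deg-⊕-disjoint removed-disjoint u ⟩
      deg e₁₂ u + deg e₃₄ u         ≡⟨ cong₂ _+_ (deg-edge v₁≢v₂ u) (deg-edge v₃≢v₄ u) ⟩
      (δ v₁ + δ v₂) + (δ v₃ + δ v₄) ≡⟨ +-interchange (δ v₁) (δ v₂) (δ v₃) (δ v₄) ⟩
      (δ v₁ + δ v₃) + (δ v₂ + δ v₄) ≡⟨ cong₂ _+_ (deg-edge v₁≢v₃ u) (deg-edge v₂≢v₄ u) ⟨
      deg e₁₃ u + deg e₂₄ u         ≡⟨ deg-⊕-disjoint added-disjoint u ⟨
      deg added u                   ∎
      where
      open ≡-Reasoning
      δ : Fin n → ℕ
      δ x = [ does (u ≟ x) ]× 1

    deg-switched : ∀ u → deg switched u ≡ deg G u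
    deg-switched u = begin
      deg switched u                      ≡⟨ deg-⊕-disjoint added∩G⊕removed=∅ u ⟩
      deg (G ⊕ removed) u + deg added u   ≡⟨ cong (deg (G ⊕ removed) u +_) (deg-removed≡deg-added u) ⟨
      deg (G ⊕ removed) u + deg removed u ≡⟨ deg-⊕-⊆ removed⊆G u ⟩
      deg G u                             ∎
      where open ≡-Reasoning

    edgeSum-removed : ∀ w → (∀ u v → w u v ≡ w v u) → edgeSum removed w ≡ w v₁ v₂ + w v₃ v₄
    edgeSum-removed w w-sym = trans (edgeSum-⊕-disjoint removed-disjoint w)
      (cong₂ _+_ (edgeSum-edge v₁≢v₂ w w-sym) (edgeSum-edge v₃≢v₄ w w-sym))

    edgeSum-added : ∀ w → (∀ u v → w u v ≡ w v u) → edgeSum added w ≡ w v₁ v₃ + w v₂ v₄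
    edgeSum-added w w-sym = trans (edgeSum-⊕-disjoint added-disjoint w)
      (cong₂ _+_ (edgeSum-edge v₁≢v₃ w w-sym) (edgeSum-edge v₂≢v₄ w w-sym))

    edgeSum-switched : ∀ w → (∀ u v → w u v ≡ w v u) →
      edgeSum switched w + (w v₁ v₂ + w v₃ v₄) ≡ edgeSum G w + (w v₁ v₃ + w v₂ v₄)
    edgeSum-switched w w-sym = begin
      edgeSum switched w + (w v₁ v₂ + w v₃ v₄)
        ≡⟨ cong₂ _+_ (edgeSum-⊕-disjoint added∩G⊕removed=∅ w) (sym (edgeSum-removed w w-sym)) ⟩
      edgeSum (G ⊕ removed) w + edgeSum added w + edgeSum removed w
        ≡⟨ +-swapʳ (edgeSum (G ⊕ removed) w) (edgeSum added w) (edgeSum removed w) ⟩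
      edgeSum (G ⊕ removed) w + edgeSum removed w + edgeSum added w
        ≡⟨ cong₂ _+_ (edgeSum-⊕-⊆ removed⊆G w) (edgeSum-added w w-sym) ⟩
      edgeSum G w + (w v₁ v₃ + w v₂ v₄) ∎
      where
      open ≡-Reasoning
      +-swapʳ : ∀ a b c → a + b + c ≡ a + c + b
      +-swapʳ = solve-∀

    ψ : ℕ → Fin n → Fin n → ℕ
    ψ k u v = somborTerm k (deg G u) (deg G v)

    SO-switched : ∀ k → SOₖ k switched + (ψ k v₁ v₂ + ψ k v₃ v₄) ≡ SOₖ k G + (ψ k v₁ v₃ + ψ k v₂ v₄)
    SO-switched k = begin
      SOₖ k switched + (ψ k v₁ v₂ + ψ k v₃ v₄)     ≡⟨ cong (_+ (ψ k v₁ v₂ + ψ k v₃ v₄)) SO-switched≡ ⟩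
      edgeSum switched (ψ k) + (ψ k v₁ v₂ + ψ k v₃ v₄) ≡⟨ edgeSum-switched (ψ k) ψ-sym ⟩
      edgeSum G (ψ k) + (ψ k v₁ v₃ + ψ k v₂ v₄)    ≡⟨ cong (_+ (ψ k v₁ v₃ + ψ k v₂ v₄)) (SOₖ≡edgeSum k G) ⟨
      SOₖ k G + (ψ k v₁ v₃ + ψ k v₂ v₄)            ∎
      where
      open ≡-Reasoning
      ψ-sym : ∀ u v → ψ k u v ≡ ψ k v u
      ψ-sym u v = somborTerm-sym k (deg G u) (deg G v)
      SO-switched≡ : SOₖ k switched ≡ edgeSum switched (ψ k)
      SO-switched≡ = trans (SOₖ≡edgeSum k switched)
        (edgeSum-cong switched λ u v → cong₂ (somborTerm k) (deg-switched u) (deg-switched v))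

    degSeq-switched : ∀ {D} → HasDegSeq G D → HasDegSeq switched D
    degSeq-switched {D} = subst (λ ds → nonPendant ds ↭ D) (sym (map-cong deg-switched (allFin n)))

    Kept : Rel (Fin n) 0ℓ
    Kept u v = Adj G u v × ¬ Adj removed u v

    Kept-sym : ∀ {u v} → Kept u v → Kept v u
    Kept-sym (g , ¬r) = Adj-sym G g , ¬r ∘ Adj-sym removed

    Kept⇒switched : ∀ {u v} → Kept u v → Adj switched u v
    Kept⇒switched (g , ¬r) = ⊕-introˡ (⊕-introˡ g ¬r) (λ a → added∩G=∅ a g)

    added⇒switched : ∀ {u v} → Adj added u v → Adj switched u v
    added⇒switched a = ⊕-disjoint-introʳ added∩G⊕removed=∅ a

    switched-elim : ∀ {u v} → Adj switched u v → Kept u v ⊎ Adj added u v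
    switched-elim s with ⊕-elim s
    ... | inj₂ (_ , a) = inj₂ a
    ... | inj₁ (g⊕r , _) with ⊕-elim g⊕r
    ...   | inj₁ kept    = inj₁ kept
    ...   | inj₂ (¬g , r) = ⊥-elim (¬g (removed⊆G r))

    Kept⇒Without₁₂ : ∀ {u v} → Kept u v → Without (Adj G) v₁ v₂ u v
    Kept⇒Without₁₂ (g , ¬r) = g , ¬r ∘ ⊕-disjoint-introˡ removed-disjoint ∘ edge-intro

    Kept⇒Without₃₄ : ∀ {u v} → Kept u v → Without (Adj G) v₃ v₄ u v
    Kept⇒Without₃₄ (g , ¬r) = g , ¬r ∘ ⊕-disjoint-introʳ removed-disjoint ∘ edge-intro

    inner-kept : Star Kept v₂ v₃
    inner-kept = Star.map kept inner
      where
      kept : ∀ {a b} → Within (Away v₁ v₄) (Adj G) a b → Kept a b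
      kept (g , (a≢v₁ , a≢v₄) , (b≢v₁ , b≢v₄)) = g , λ r → case removed-elim r of λ where
        (inj₁ e) → ¬SameEdge-endpoint a≢v₁ b≢v₁ e
        (inj₂ e) → ¬SameEdge-endpoint a≢v₄ b≢v₄ (SameEdge-swap e)

    Kept-reverse : ∀ {a b} → Star Kept a b → Star Kept b a
    Kept-reverse = Star.reverse Kept-sym

    -- G minus the removed edges has three components, containing v₁, v₂ and v₃, and v₄.
    no-Kept-v₁v₂ : ¬ Star Kept v₁ v₂
    no-Kept-v₁v₂ = G-bridge v₁v₂∈G ∘ Star.map Kept⇒Without₁₂

    no-Kept-v₃v₄ : ¬ Star Kept v₃ v₄
    no-Kept-v₃v₄ = G-bridge v₃v₄∈G ∘ Star.map Kept⇒Without₃₄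

    no-Kept-v₁v₄ : ¬ Star Kept v₁ v₄
    no-Kept-v₁v₄ walk = G-bridge v₁v₂∈G
      (Star.map Kept⇒Without₁₂ walk ◅◅ (v₄v₃ ◅ Star.map Kept⇒Without₁₂ (Kept-reverse inner-kept)))
      where
      v₄v₃ : Without (Adj G) v₁ v₂ v₄ v₃
      v₄v₃ = Adj-sym G v₃v₄∈G , ¬SameEdge-endpoint (v₁≢v₄ ∘ sym) (v₁≢v₃ ∘ sym)

    Near-v₁ Near-v₄ : Fin n → Set
    Near-v₁ a = Star Kept a v₁
    Near-v₄ a = Star Kept a v₄

    bridge₁₃ : IsBridge (Adj switched) v₁ v₃
    bridge₁₃ walk = no-Kept-v₁v₂ (Kept-reverse (inner-kept ◅◅ Star-preserves Near-v₁ preserved walk ε))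
      where
      preserved : ∀ {a b} → Without (Adj switched) v₁ v₃ a b → Near-v₁ a → Near-v₁ b
      preserved (s , ¬e) near with switched-elim s
      ... | inj₁ kept = Kept-sym kept ◅ near
      ... | inj₂ a with added-elim a
      ...   | inj₁ e                 = ⊥-elim (¬e e)
      ...   | inj₂ (inj₁ (refl , _)) = ⊥-elim (no-Kept-v₁v₂ (Kept-reverse near))
      ...   | inj₂ (inj₂ (refl , _)) = ⊥-elim (no-Kept-v₁v₄ (Kept-reverse near))

    bridge₄₂ : IsBridge (Adj switched) v₄ v₂
    bridge₄₂ walk = no-Kept-v₃v₄ (Kept-reverse inner-kept ◅◅ Star-preserves Near-v₄ preserved walk ε)
      where
      preserved : ∀ {a b} → Without (Adj switched) v₄ v₂ a b → Near-v₄ a → Near-v₄ b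
      preserved (s , ¬e) near with switched-elim s
      ... | inj₁ kept = Kept-sym kept ◅ near
      ... | inj₂ a with added-elim a
      ...   | inj₂ e                 = ⊥-elim (¬e (SameEdge-swap e))
      ...   | inj₁ (inj₁ (refl , _)) = ⊥-elim (no-Kept-v₁v₄ near)
      ...   | inj₁ (inj₂ (refl , _)) = ⊥-elim (no-Kept-v₃v₄ near)

    added-bridge : ∀ {u v} → Adj added u v → IsBridge (Adj switched) u v
    added-bridge {u} {v} a with added-elim a
    ... | inj₁ (inj₁ (refl , refl)) = bridge₁₃
    ... | inj₁ (inj₂ (refl , refl)) = IsBridge-sym (Adj-sym switched) bridge₁₃
    ... | inj₂ (inj₁ (refl , refl)) = IsBridge-sym (Adj-sym switched) bridge₄₂
    ... | inj₂ (inj₂ (refl , refl)) = bridge₄₂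

    inner-switched : Star (Adj switched) v₂ v₃
    inner-switched = Star.map Kept⇒switched inner-kept

    inner-switched⁻¹ : Star (Adj switched) v₃ v₂
    inner-switched⁻¹ = Star.reverse (Adj-sym switched) inner-switched

    switched-added : ∀ {u v} → SameEdge v₁ v₃ u v ⊎ SameEdge v₂ v₄ u v → Adj switched u v
    switched-added = added⇒switched ∘ added-intro

    reconnect : ∀ {u v} → Adj G u v → Star (Adj switched) u v
    reconnect {u} {v} g with T? (adj removed u v)
    ... | no ¬r = Kept⇒switched (g , ¬r) ◅ ε
    ... | yes r with removed-elim r
    ...   | inj₁ (inj₁ (refl , refl)) = switched-added (inj₁ (inj₁ (refl , refl))) ◅ inner-switched⁻¹
    ...   | inj₁ (inj₂ (refl , refl)) = inner-switched ◅◅ (switched-added (inj₁ (inj₂ (refl , refl))) ◅ ε)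
    ...   | inj₂ (inj₁ (refl , refl)) = inner-switched⁻¹ ◅◅ (switched-added (inj₂ (inj₁ (refl , refl))) ◅ ε)
    ...   | inj₂ (inj₂ (refl , refl)) = switched-added (inj₂ (inj₂ (refl , refl))) ◅ inner-switched

    switched-isTree : IsTree switched
    switched-isTree =
      (λ u v → star⇒walk ((reconnect ⋆) (walk⇒star (connected u v)))) ,
      acyclic-by-bridges {G = G} {H = switched} {X = added} acyclic
        (λ s ¬a → [ proj₁ , ⊥-elim ∘ ¬a ]′ (switched-elim s)) added-bridge

path⇒switchPath : ∀ {n} {T : Graph n} {v₁ v₂ v₃ v₄} mid →
  IsPath T (v₁ ∷ v₂ ∷ mid ++ v₃ ∷ v₄ ∷ []) → SwitchPath T v₁ v₂ v₃ v₄
path⇒switchPath {v₁ = v₁} {v₂} {v₃} {v₄} mid ((v₁∉ ∷ v₂∉ ∷ unique) , (v₁v₂ ∷ linked)) = record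
  { v₁v₂∈G = v₁v₂
  ; v₃v₄∈G = proj₂ (Linked-∷ʳ⁻ (v₂ ∷ mid) linked)
  ; inner  = Linked⇒Star v₂ mid v₃ (proj₁ (Linked-∷ʳ⁻ (v₂ ∷ mid) linked)) away
  ; v₁≢v₃  = All.head v₁∉v₃v₄
  ; v₁≢v₄  = All.head (All.tail v₁∉v₃v₄)
  ; v₂≢v₃  = All.head v₂∉v₃v₄
  ; v₂≢v₄  = All.head (All.tail v₂∉v₃v₄)
  }
  where
  v₁∉v₃v₄ : All (v₁ ≢_) (v₃ ∷ v₄ ∷ [])
  v₁∉v₃v₄ = All.++⁻ʳ mid (All.tail v₁∉)
  v₂∉v₃v₄ : All (v₂ ≢_) (v₃ ∷ v₄ ∷ [])
  v₂∉v₃v₄ = All.++⁻ʳ mid v₂∉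
  away : All (Away v₁ v₄) (v₂ ∷ mid ++ v₃ ∷ [])
  away = All.zipWith (λ (≢v₁ , ≢v₄) → (λ eq → ≢v₁ (sym eq)) , ≢v₄)
    (All-dropLast (v₂ ∷ mid) v₁∉ , Unique⇒last∉ (v₂ ∷ mid) (v₂∉ ∷ unique))

no-room : ∀ {g h x y L} → h + y ≡ g + x → g ≤ h + L → x + suc L ≤ y → ⊥
no-room {g} {h} {x} {y} {L} h+y≡g+x g≤h+L x+L<y = <-irrefl (sym h+y≡g+x) (begin-strict
  g + x           ≤⟨ +-monoˡ-≤ x g≤h+L ⟩
  h + L + x       <⟨ subst (suc (h + L + x) ≤_) (regroup h L x) ≤-refl ⟩
  h + (x + suc L) ≤⟨ +-monoʳ-≤ h x+L<y ⟩
  h + y           ∎)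
  where
  open ≤-Reasoning
  regroup : ∀ h L x → suc (h + L + x) ≡ h + (x + suc L)
  regroup = solve-∀

mainTheorem2 : (D : List ℕ) (n : ℕ) (T : Graph n) → IsSOMinimal D T →
    (v₁ v₂ : Fin n) (mid : List (Fin n)) (vₜ₋₁ vₜ : Fin n) →
    IsPath T (v₁ ∷ v₂ ∷ mid ++ vₜ₋₁ ∷ vₜ ∷ []) →
    deg T v₁ < deg T vₜ →
    deg T v₂ ≤ deg T vₜ₋₁
mainTheorem2 D n T (tree , degSeq , minimal) v₁ v₂ mid v₃ v₄ isPath d₁<d₄ = ≮⇒≥ λ d₃<d₂ →
  let open TwoSwitch tree (path⇒switchPath mid isPath)
      (k , gain) = switch-gain (suc (length (somborRadicands switched))) d₁<d₄ d₃<d₂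
  in no-room (SO-switched k) (minimal n switched switched-isTree (degSeq-switched degSeq) k) gain
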